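{- Let $k \geq 2$, $p \geq 2$ and $0 \leq r < p$ be integers. Let $d_{p}(n,k,r)$ be the number of partitions of $n$ in which exactly one part congruent to $r \pmod{p}$ appears at least $k$ times (every other part congruent to $r \pmod p$ appears at most $k-1$ times), while parts not congruent to $r \pmod{p}$ appear with unrestricted multiplicity. Let $f_{p}(n,k,r)$ be the number of partitions of $n$ in which the set of (distinct values of) parts congruent to $kr \pmod{pk}$ has exactly one element (other parts unrestricted). Then for every integer $n \geq 1$, $$f_{p}(n,k,r) = d_{p}(n,k,r).$$ -}

module Defs where

open import Data.Nat using (ℕ; zero; suc; _∸_; _≤ᵇ_; _≡ᵇ_; _*_; _%_; NonZero)
open import Data.Bool using (Bool; true; false; _∧_)
open import Data.List using (List; []; _∷_; [_]; map; concatMap; filterᵇ; length; upTo; deduplicateᵇ)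

-- A partition of n is represented as a weakly decreasing list of positive
-- naturals summing to n.  `boundedPartitions fuel n m` lists all partitions of n
-- whose parts are all ≤ m (fuel ≥ n guarantees completeness: each step removes
-- a part of size ≥ 1).
boundedPartitions : ℕ → ℕ → ℕ → List (List ℕ)
boundedPartitions _        zero    _ = [ [] ]
boundedPartitions zero     (suc n) _ = []
boundedPartitions (suc fu) (suc n) m =
  concatMap (λ j → map (j ∷_) (boundedPartitions fu (suc n ∸ j) j))
            (filterᵇ (λ j → j ≤ᵇ suc n) (map suc (upTo m)))

partitions : ℕ → List (List ℕ)
partitions n = boundedPartitions n n n

mult : ℕ → List ℕ → ℕ
mult v xs = length (filterᵇ (λ x → x ≡ᵇ v) xs)

distinctParts : List ℕ → List ℕ
distinctParts = deduplicateᵇ _≡ᵇ_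

countPartitions : (List ℕ → Bool) → ℕ → ℕ
countPartitions P n = length (filterᵇ P (partitions n))

dCond : (p k r : ℕ) → .{{NonZero p}} → List ℕ → Bool
dCond p k r xs =
  length (filterᵇ (λ v → (v % p ≡ᵇ r) ∧ (k ≤ᵇ mult v xs)) (distinctParts xs)) ≡ᵇ 1

fCond : (p k r : ℕ) → .{{NonZero (p * k)}} → List ℕ → Bool
fCond p k r xs =
  length (filterᵇ (λ v → v % (p * k) ≡ᵇ k * r) (distinctParts xs)) ≡ᵇ 1

d : (p k r : ℕ) → .{{NonZero p}} → ℕ → ℕ
d p k r n = countPartitions (dCond p k r) n

f : (p k r : ℕ) → .{{NonZero (p * k)}} → ℕ → ℕ
f p k r n = countPartitions (fCond p k r) n

module Submission where

-- Parts congruent to k r modulo p k are exactly the numbers k v with v ≡ r (mod p).  So, with V the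
-- values in [1, n] congruent to r modulo p, d counts the partitions of n in which exactly one v ∈ V
-- occurs at least k times, and f those in which exactly one k v (v ∈ V) occurs at least once.
-- More generally, the number of partitions of n in which exactly j values of V occur at least c
-- times depends only on the weights c v (v ∈ V): removing c copies of the first value v of V
-- expresses the count for v ∷ V through the counts for V at n and at n − c v, so induction on V
-- compares (c, V) = (k, V) with (1, k V).

open import Defs
open import Data.Nat
  using (ℕ; zero; suc; _+_; _∸_; _*_; _≤_; _<_; _≤ᵇ_; _≡ᵇ_; z≤n; s≤s; s≤s⁻¹; NonZero; >-nonZero; >-nonZero⁻¹)
open import Data.Nat.Properties
open import Data.Nat.DivMod
  using (_/_; _%_; m%n*o≡m*o%[n*o]; m%[n*o]/o≡m/o%n; m*n/n≡m; m*[n/m]≡n; m/n≤m)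
open import Data.Nat.Divisibility using (_∣_; ∣n∣m%n⇒∣m; n∣m*n; m∣m*n)
open import Data.Nat.ListAction using (sum)
open import Data.Nat.ListAction.Properties using (sum-↭)
open import Data.Bool using (Bool; true; false; T; not; _∧_; if_then_else_)
open import Data.Bool.Properties using (T-≡; T-∧; if-eta; if-cong-then)
open import Data.Empty using (⊥-elim)
open import Data.List using (List; []; _∷_; map; filterᵇ; length; upTo; _++_)
open import Data.List.Properties using (length-++; ∷-injective; filter-none; map-id-local)
open import Data.List.Membership.Propositional using (_∈_; find; lose)
open import Data.List.Membership.Propositional.Properties
import Data.List.Membership.Setoid.Properties as SetoidMembership
open import Data.List.Relation.Unary.Any using (here; there)
open import Data.List.Relation.Unary.All as All using (All; []; _∷_)
import Data.List.Relation.Unary.All.Properties as All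
open import Data.List.Relation.Unary.AllPairs as AllPairs using ([]; _∷_)
import Data.List.Relation.Unary.AllPairs.Properties as AllPairs
open import Data.List.Relation.Unary.Unique.Propositional using (Unique)
import Data.List.Relation.Unary.Unique.Propositional.Properties as Unique
open import Data.List.Relation.Binary.Disjoint.Propositional using (Disjoint)
open import Data.List.Relation.Binary.Permutation.Propositional
  using (_↭_; ↭-refl; ↭-prep; ↭-swap; ↭-trans)
open import Data.List.Relation.Binary.Permutation.Propositional.Properties using (↭-length; filter-↭)
open import Data.Product using (_×_; _,_; proj₁; proj₂; map₁; map₂; uncurry)
open import Data.Sum using (inj₁; inj₂)
open import Function using (_∘_; _∘₂_; Equivalence)
open import Relation.Nullary using (¬_)
open import Relation.Nullary.Decidable using (T?; ¬?)
open import Relation.Binary.PropositionalEquality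
  using (_≡_; _≢_; ≢-sym; setoid; refl; sym; trans; cong; cong₂; subst; module ≡-Reasoning)

≡ᵇ-refl : ∀ n → (n ≡ᵇ n) ≡ true
≡ᵇ-refl zero    = refl
≡ᵇ-refl (suc n) = ≡ᵇ-refl n

¬T⇒≡false : ∀ {b} → ¬ T b → b ≡ false
¬T⇒≡false {false} _  = refl
¬T⇒≡false {true}  ¬t = ⊥-elim (¬t _)

≢⇒≡ᵇ≡false : ∀ {m n} → m ≢ n → (m ≡ᵇ n) ≡ false
≢⇒≡ᵇ≡false {m} {n} m≢n = ¬T⇒≡false (m≢n ∘ ≡ᵇ⇒≡ m n)

module _ {A : Set} where

  ∈-filterᵇ⁻ : ∀ (P : A → Bool) {x xs} → x ∈ filterᵇ P xs → x ∈ xs × T (P x)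
  ∈-filterᵇ⁻ P = ∈-filter⁻ (T? ∘ P)

  ∈-filterᵇ⁺ : ∀ (P : A → Bool) {x xs} → x ∈ xs → T (P x) → x ∈ filterᵇ P xs
  ∈-filterᵇ⁺ P = ∈-filter⁺ (T? ∘ P)

  filterᵇ-unique : ∀ (P : A → Bool) {xs} → Unique xs → Unique (filterᵇ P xs)
  filterᵇ-unique P = Unique.filter⁺ (T? ∘ P)

  filterᵇ-cong : ∀ {P Q : A → Bool} xs → (∀ {x} → x ∈ xs → P x ≡ Q x) → filterᵇ P xs ≡ filterᵇ Q xs
  filterᵇ-cong []       _   = refl
  filterᵇ-cong {P} {Q} (x ∷ xs) P≡Q
    with P x | Q x | P≡Q (here refl) | filterᵇ-cong xs (P≡Q ∘ there)
  ... | true  | .true  | refl | ih = cong (x ∷_) ih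
  ... | false | .false | refl | ih = ih

  length-filterᵇ-if : ∀ (c q r : A → Bool) xs →
    length (filterᵇ (λ x → if c x then r x else q x) xs) ≡
    length (filterᵇ (λ x → not (c x) ∧ q x) xs) + length (filterᵇ (λ x → c x ∧ r x) xs)
  length-filterᵇ-if c q r [] = refl
  length-filterᵇ-if c q r (x ∷ xs) with c x | q x | r x | length-filterᵇ-if c q r xs
  ... | true  | _     | true  | ih = trans (cong suc ih) (sym (+-suc _ _))
  ... | true  | _     | false | ih = ih
  ... | false | true  | _     | ih = cong suc ih
  ... | false | false | _     | ih = ih

length-≤-byInjection : ∀ {A B : Set} {xs : List A} {ys : List B} (f : A → B) (g : B → A) →
  Unique xs → (∀ {x} → x ∈ xs → f x ∈ ys) → (∀ {x} → x ∈ xs → g (f x) ≡ x) →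
  length xs ≤ length ys
length-≤-byInjection {xs = []} f g _ _ _ = z≤n
length-≤-byInjection {xs = x ∷ xs} f g (x∉xs ∷ unique) into inverse
  with as , bs , refl ← ∈-∃++ (into (here refl)) = begin
    suc (length xs)               ≤⟨ s≤s (length-≤-byInjection f g unique into′ (inverse ∘ there)) ⟩
    suc (length (as ++ bs))       ≡⟨ cong suc (length-++ as) ⟩
    suc (length as + length bs)   ≡⟨ +-suc (length as) (length bs) ⟨
    length as + length (f x ∷ bs) ≡⟨ length-++ as ⟨
    length (as ++ f x ∷ bs)       ∎
  where
  open ≤-Reasoning
  into′ : ∀ {y} → y ∈ xs → f y ∈ as ++ bs
  into′ {y} y∈xs with ∈-++⁻ as (into (there y∈xs))
  ... | inj₁ p            = ∈-++⁺ˡ p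
  ... | inj₂ (there p)    = ∈-++⁺ʳ as p
  ... | inj₂ (here fy≡fx) = ⊥-elim (All.lookup x∉xs y∈xs
    (trans (sym (inverse (here refl))) (trans (cong g (sym fy≡fx)) (inverse (there y∈xs)))))

length-≡-byBijection : ∀ {A B : Set} {xs : List A} {ys : List B} (f : A → B) (g : B → A) →
  Unique xs → Unique ys → (∀ {x} → x ∈ xs → f x ∈ ys) → (∀ {y} → y ∈ ys → g y ∈ xs) →
  (∀ {x} → x ∈ xs → g (f x) ≡ x) → (∀ {y} → y ∈ ys → f (g y) ≡ y) →
  length xs ≡ length ys
length-≡-byBijection f g uxs uys f∈ g∈ gf fg =
  ≤-antisym (length-≤-byInjection f g uxs f∈ gf) (length-≤-byInjection g f uys g∈ fg)

length-≡-bySameElements : ∀ {A : Set} {xs ys : List A} → Unique xs → Unique ys →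
  (∀ {x} → x ∈ xs → x ∈ ys) → (∀ {x} → x ∈ ys → x ∈ xs) → length xs ≡ length ys
length-≡-bySameElements uxs uys xs⊆ys ys⊆xs =
  length-≡-byBijection (λ x → x) (λ x → x) uxs uys xs⊆ys ys⊆xs (λ _ → refl) (λ _ → refl)

-- Enumerating partitions

oneTo : ℕ → List ℕ
oneTo n = map suc (upTo n)

∈-oneTo⁺ : ∀ {n v} → 1 ≤ v → v ≤ n → v ∈ oneTo n
∈-oneTo⁺ {v = suc i} _ i<n = ∈-map⁺ suc (∈-upTo⁺ i<n)

∈-oneTo⁻ : ∀ {n v} → v ∈ oneTo n → 1 ≤ v × v ≤ n
∈-oneTo⁻ v∈ with i , i∈ , refl ← ∈-map⁻ suc v∈ = s≤s z≤n , ∈-upTo⁻ i∈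

oneTo-unique : ∀ n → Unique (oneTo n)
oneTo-unique n = Unique.map⁺ suc-injective (Unique.upTo⁺ n)

data Descending : ℕ → List ℕ → Set where
  []   : ∀ {m} → Descending m []
  cons : ∀ {m v xs} → 1 ≤ v → v ≤ m → Descending v xs → Descending m (v ∷ xs)

Descending-weaken : ∀ {m m′ xs} → m ≤ m′ → Descending m xs → Descending m′ xs
Descending-weaken m≤m′ []               = []
Descending-weaken m≤m′ (cons 1≤v v≤m d) = cons 1≤v (≤-trans v≤m m≤m′) d

Descending-sum : ∀ {m xs} → Descending m xs → Descending (sum xs) xs
Descending-sum []                           = []
Descending-sum {xs = v ∷ xs} (cons 1≤v _ d) = cons 1≤v (m≤m+n v (sum xs)) d

∈-Descending : ∀ {m v xs} → Descending m xs → v ∈ xs → 1 ≤ v × v ≤ m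
∈-Descending (cons 1≤v v≤m d) (here refl) = 1≤v , v≤m
∈-Descending (cons _ x≤m d)   (there v∈)  = map₂ (λ v≤x → ≤-trans v≤x x≤m) (∈-Descending d v∈)

IsPartition : ℕ → List ℕ → Set
IsPartition n xs = Descending n xs × sum xs ≡ n

∈-boundedPartitions⁻ : ∀ fuel n m {xs} → xs ∈ boundedPartitions fuel n m →
                       Descending m xs × sum xs ≡ n
∈-boundedPartitions⁻ fuel       zero    m (here refl) = [] , refl
∈-boundedPartitions⁻ (suc fuel) (suc n) m xs∈
  with j , j∈ , xs∈′ ← find (∈-concatMap⁻ (λ j → map (j ∷_) (boundedPartitions fuel (suc n ∸ j) j))
                                          {xs = filterᵇ (λ j → j ≤ᵇ suc n) (oneTo m)} xs∈)
  with ys , ys∈ , refl ← ∈-map⁻ (j ∷_) xs∈′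
  with j∈oneTo , j≤n ← ∈-filterᵇ⁻ (λ j → j ≤ᵇ suc n) j∈
  with 1≤j , j≤m ← ∈-oneTo⁻ j∈oneTo
  with d , sum≡ ← ∈-boundedPartitions⁻ fuel (suc n ∸ j) j ys∈ =
  cons 1≤j j≤m d , trans (cong (j +_) sum≡) (m+[n∸m]≡n (≤ᵇ⇒≤ j (suc n) j≤n))

∈-boundedPartitions⁺ : ∀ fuel n m {xs} → n ≤ fuel → Descending m xs → sum xs ≡ n →
                       xs ∈ boundedPartitions fuel n m
∈-boundedPartitions⁺ fuel       zero    m {[]}         _ _             _ = here refl
∈-boundedPartitions⁺ fuel       zero    m {zero ∷ ys}  _ (cons () _ _) _
∈-boundedPartitions⁺ fuel       zero    m {suc j ∷ ys} _ _             ()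
∈-boundedPartitions⁺ fuel       (suc n) m {[]}         _ _             ()
∈-boundedPartitions⁺ (suc fuel) (suc n) m {j ∷ ys} (s≤s n≤fuel) (cons 1≤j j≤m d) sum≡ =
  ∈-concatMap⁺ (λ j → map (j ∷_) (boundedPartitions fuel (suc n ∸ j) j))
    (lose j∈ (∈-map⁺ (j ∷_) (∈-boundedPartitions⁺ fuel (suc n ∸ j) j n∸j≤fuel d sum-ys)))
  where
  j≤n : j ≤ suc n
  j≤n = subst (j ≤_) sum≡ (m≤m+n j (sum ys))
  j∈ : j ∈ filterᵇ (λ j → j ≤ᵇ suc n) (oneTo m)
  j∈ = ∈-filterᵇ⁺ (λ j → j ≤ᵇ suc n) (∈-oneTo⁺ 1≤j j≤m) (≤⇒≤ᵇ j≤n)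
  n∸j≤fuel : suc n ∸ j ≤ fuel
  n∸j≤fuel = ≤-trans (∸-monoʳ-≤ (suc n) 1≤j) n≤fuel
  sum-ys : sum ys ≡ suc n ∸ j
  sum-ys = trans (sym (m+n∸m≡n j (sum ys))) (cong (_∸ j) sum≡)

boundedPartitions-unique : ∀ fuel n m → Unique (boundedPartitions fuel n m)
boundedPartitions-unique fuel       zero    m = [] ∷ []
boundedPartitions-unique zero       (suc n) m = []
boundedPartitions-unique (suc fuel) (suc n) m =
  Unique.concat⁺
    (All.map⁺ (All.universal (λ j → Unique.map⁺ (proj₂ ∘ ∷-injective)
                                      (boundedPartitions-unique fuel (suc n ∸ j) j)) _))
    (AllPairs.map⁺ (AllPairs.map disjoint (filterᵇ-unique (λ j → j ≤ᵇ suc n) (oneTo-unique m))))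
  where
  disjoint : ∀ {i j} → i ≢ j → Disjoint (map (i ∷_) (boundedPartitions fuel (suc n ∸ i) i))
                                        (map (j ∷_) (boundedPartitions fuel (suc n ∸ j) j))
  disjoint i≢j (xs∈ , xs∈′)
    with _ , _ , refl ← ∈-map⁻ _ xs∈ | _ , _ , eq ← ∈-map⁻ _ xs∈′ = i≢j (proj₁ (∷-injective eq))

∈-partitions⁻ : ∀ {n xs} → xs ∈ partitions n → IsPartition n xs
∈-partitions⁻ {n} = ∈-boundedPartitions⁻ n n n

∈-partitions⁺ : ∀ {n xs} → IsPartition n xs → xs ∈ partitions n
∈-partitions⁺ {n} (d , sum≡) = ∈-boundedPartitions⁺ n n n ≤-refl d sum≡

PartitionWith : (List ℕ → Bool) → ℕ → List ℕ → Set
PartitionWith P n xs = IsPartition n xs × T (P xs)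

module _ {P : List ℕ → Bool} {n : ℕ} where

  ∈-countedPartitions⁻ : ∀ {xs} → xs ∈ filterᵇ P (partitions n) → PartitionWith P n xs
  ∈-countedPartitions⁻ xs∈ = map₁ ∈-partitions⁻ (∈-filterᵇ⁻ P xs∈)

  ∈-countedPartitions⁺ : ∀ {xs} → PartitionWith P n xs → xs ∈ filterᵇ P (partitions n)
  ∈-countedPartitions⁺ (partition , Pxs) = ∈-filterᵇ⁺ P (∈-partitions⁺ partition) Pxs

  countedPartitions-unique : Unique (filterᵇ P (partitions n))
  countedPartitions-unique = filterᵇ-unique P (boundedPartitions-unique n n n)

countPartitions-byBijection : ∀ {P Q : List ℕ → Bool} {n m} (f g : List ℕ → List ℕ) →
  (∀ {xs} → PartitionWith P n xs → PartitionWith Q m (f xs)) →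
  (∀ {ys} → PartitionWith Q m ys → PartitionWith P n (g ys)) →
  (∀ {xs} → PartitionWith P n xs → g (f xs) ≡ xs) →
  (∀ {ys} → PartitionWith Q m ys → f (g ys) ≡ ys) →
  countPartitions P n ≡ countPartitions Q m
countPartitions-byBijection {P} {Q} {n} {m} f g f∈ g∈ gf fg =
  length-≡-byBijection f g (countedPartitions-unique {P} {n}) (countedPartitions-unique {Q} {m})
    (λ xs∈ → ∈-countedPartitions⁺ {Q} {m} (f∈ (∈-countedPartitions⁻ {P} {n} xs∈)))
    (λ ys∈ → ∈-countedPartitions⁺ {P} {n} (g∈ (∈-countedPartitions⁻ {Q} {m} ys∈)))
    (λ xs∈ → gf (∈-countedPartitions⁻ {P} {n} xs∈))
    (λ ys∈ → fg (∈-countedPartitions⁻ {Q} {m} ys∈))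

countPartitions-cong : ∀ {P Q : List ℕ → Bool} n →
  (∀ {xs} → IsPartition n xs → P xs ≡ Q xs) → countPartitions P n ≡ countPartitions Q n
countPartitions-cong n P≡Q = cong length (filterᵇ-cong (partitions n) (P≡Q ∘ ∈-partitions⁻))

countPartitions-none : ∀ {P : List ℕ → Bool} n →
  (∀ {xs} → IsPartition n xs → ¬ T (P xs)) → countPartitions P n ≡ 0
countPartitions-none {P} n ¬P = cong length (filter-none (T? ∘ P) (All.tabulate (¬P ∘ ∈-partitions⁻)))

countPartitions-if : ∀ (C Q R : List ℕ → Bool) n →
  countPartitions (λ xs → if C xs then R xs else Q xs) n ≡
  countPartitions (λ xs → not (C xs) ∧ Q xs) n + countPartitions (λ xs → C xs ∧ R xs) n
countPartitions-if C Q R n = length-filterᵇ-if C Q R (partitions n)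

countPartitions-split : ∀ (C P : List ℕ → Bool) n →
  countPartitions P n ≡
  countPartitions (λ xs → not (C xs) ∧ P xs) n + countPartitions (λ xs → C xs ∧ P xs) n
countPartitions-split C P n = trans
  (countPartitions-cong {Q = λ xs → if C xs then P xs else P xs} n (λ {xs} _ → sym (if-eta (C xs))))
  (countPartitions-if C P P n)

occursAtLeast : ℕ → ℕ → List ℕ → Bool
occursAtLeast c v xs = c ≤ᵇ mult v xs

insert : ℕ → List ℕ → List ℕ
insert v []       = v ∷ []
insert v (x ∷ xs) = if x ≤ᵇ v then v ∷ x ∷ xs else x ∷ insert v xs

remove : ℕ → List ℕ → List ℕ
remove v []       = []
remove v (x ∷ xs) = if x ≡ᵇ v then xs else x ∷ remove v xs

insert-↭ : ∀ v xs → insert v xs ↭ v ∷ xs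
insert-↭ v []       = ↭-refl
insert-↭ v (x ∷ xs) with x ≤ᵇ v
... | true  = ↭-refl
... | false = ↭-trans (↭-prep x (insert-↭ v xs)) (↭-swap x v ↭-refl)

mult-↭ : ∀ u {xs ys} → xs ↭ ys → mult u xs ≡ mult u ys
mult-↭ u xs↭ys = ↭-length (filter-↭ (T? ∘ (_≡ᵇ u)) xs↭ys)

mult-insert-≡ : ∀ v xs → mult v (insert v xs) ≡ suc (mult v xs)
mult-insert-≡ v xs rewrite mult-↭ v (insert-↭ v xs) | ≡ᵇ-refl v = refl

mult-insert-≢ : ∀ {u v} xs → u ≢ v → mult u (insert v xs) ≡ mult u xs
mult-insert-≢ {u} {v} xs u≢v rewrite mult-↭ u (insert-↭ v xs) | ≢⇒≡ᵇ≡false (≢-sym u≢v) = refl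

sum-insert : ∀ v xs → sum (insert v xs) ≡ v + sum xs
sum-insert v xs = sum-↭ (insert-↭ v xs)

mult⇒∈ : ∀ {v} xs → 1 ≤ mult v xs → v ∈ xs
mult⇒∈ {v} (x ∷ xs) 1≤mult with x ≡ᵇ v in eq
... | true  = here (sym (≡ᵇ⇒≡ x v (Equivalence.from T-≡ eq)))
... | false = there (mult⇒∈ xs 1≤mult)

∈⇒mult : ∀ {v xs} → v ∈ xs → 1 ≤ mult v xs
∈⇒mult {v} {v ∷ xs} (here refl) rewrite ≡ᵇ-refl v = s≤s z≤n
∈⇒mult {v} {x ∷ xs} (there v∈) with x ≡ᵇ v
... | true  = s≤s z≤n
... | false = ∈⇒mult v∈

insert-head : ∀ {m v xs} → Descending m xs → m ≤ v → insert v xs ≡ v ∷ xs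
insert-head []                              _   = refl
insert-head {v = v} {x ∷ _} (cons _ x≤m _) m≤v
  rewrite Equivalence.to T-≡ (≤⇒≤ᵇ (≤-trans x≤m m≤v)) = refl

insert-tail : ∀ {v x} xs → v < x → insert v (x ∷ xs) ≡ x ∷ insert v xs
insert-tail {v} {x} xs v<x rewrite ¬T⇒≡false (<⇒≱ v<x ∘ ≤ᵇ⇒≤ x v) = refl

insert-Descending : ∀ {m v xs} → Descending m xs → 1 ≤ v → v ≤ m → Descending m (insert v xs)
insert-Descending []               1≤v v≤m = cons 1≤v v≤m []
insert-Descending {v = v} {x ∷ xs} (cons 1≤x x≤m d) 1≤v v≤m with x ≤ᵇ v in x≤v
... | true  = cons 1≤v v≤m (cons 1≤x (≤ᵇ⇒≤ x v (Equivalence.from T-≡ x≤v)) d)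
... | false = cons 1≤x x≤m (insert-Descending d 1≤v (≮⇒≥ λ x<v → subst T x≤v (≤⇒≤ᵇ (<⇒≤ x<v))))

remove-Descending : ∀ {m v xs} → Descending m xs → Descending m (remove v xs)
remove-Descending []                                 = []
remove-Descending {v = v} {x ∷ xs} (cons 1≤x x≤m d) with x ≡ᵇ v
... | true  = Descending-weaken x≤m d
... | false = cons 1≤x x≤m (remove-Descending d)

remove-insert : ∀ v xs → remove v (insert v xs) ≡ xs
remove-insert v []       rewrite ≡ᵇ-refl v = refl
remove-insert v (x ∷ xs) with x ≤ᵇ v in x≤v
... | true  rewrite ≡ᵇ-refl v = refl
... | false rewrite ≢⇒≡ᵇ≡false {x} {v} (λ { refl → subst T x≤v (≤⇒≤ᵇ (≤-refl {v})) }) =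
  cong (x ∷_) (remove-insert v xs)

insert-remove : ∀ {m v xs} → Descending m xs → v ∈ xs → insert v (remove v xs) ≡ xs
insert-remove {v = v} {x ∷ xs} (cons _ _ d) v∈ with x ≡ᵇ v in x≡ᵇv
... | true  = trans (insert-head d (≤-reflexive x≡v)) (cong (_∷ xs) (sym x≡v))
  where
  x≡v : x ≡ v
  x≡v = ≡ᵇ⇒≡ x v (Equivalence.from T-≡ x≡ᵇv)
... | false with v∈
...   | here refl  = ⊥-elim (subst T x≡ᵇv (≡⇒≡ᵇ v v refl))
...   | there v∈xs = trans (insert-tail (remove v xs) v<x) (cong (x ∷_) (insert-remove d v∈xs))
  where
  v<x : v < x
  v<x = ≤∧≢⇒< (proj₂ (∈-Descending d v∈xs)) (λ v≡x → subst T x≡ᵇv (≡⇒≡ᵇ x v (sym v≡x)))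

mult-remove : ∀ {m v xs} → Descending m xs → v ∈ xs → suc (mult v (remove v xs)) ≡ mult v xs
mult-remove {v = v} {xs} d v∈ =
  trans (sym (mult-insert-≡ v (remove v xs))) (cong (mult v) (insert-remove d v∈))

insertCopies : ℕ → ℕ → List ℕ → List ℕ
insertCopies zero    v xs = xs
insertCopies (suc c) v xs = insert v (insertCopies c v xs)

removeCopies : ℕ → ℕ → List ℕ → List ℕ
removeCopies zero    v xs = xs
removeCopies (suc c) v xs = removeCopies c v (remove v xs)

insertCopies-Descending : ∀ c {m v xs} → Descending m xs → 1 ≤ v → v ≤ m →
                          Descending m (insertCopies c v xs)
insertCopies-Descending zero    d 1≤v v≤m = d
insertCopies-Descending (suc c) d 1≤v v≤m =
  insert-Descending (insertCopies-Descending c d 1≤v v≤m) 1≤v v≤m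

removeCopies-Descending : ∀ c {m v xs} → Descending m xs → Descending m (removeCopies c v xs)
removeCopies-Descending zero    d = d
removeCopies-Descending (suc c) d = removeCopies-Descending c (remove-Descending d)

sum-insertCopies : ∀ c v xs → sum (insertCopies c v xs) ≡ c * v + sum xs
sum-insertCopies zero    v xs = refl
sum-insertCopies (suc c) v xs = begin
  sum (insert v (insertCopies c v xs)) ≡⟨ sum-insert v (insertCopies c v xs) ⟩
  v + sum (insertCopies c v xs)        ≡⟨ cong (v +_) (sum-insertCopies c v xs) ⟩
  v + (c * v + sum xs)                 ≡⟨ +-assoc v (c * v) (sum xs) ⟨
  suc c * v + sum xs                   ∎
  where open ≡-Reasoning

mult-insertCopies : ∀ c v xs → mult v (insertCopies c v xs) ≡ c + mult v xs
mult-insertCopies zero    v xs = refl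
mult-insertCopies (suc c) v xs =
  trans (mult-insert-≡ v (insertCopies c v xs)) (cong suc (mult-insertCopies c v xs))

insertCopies-invariant : ∀ {v} {P : List ℕ → Bool} → (∀ xs → P (insert v xs) ≡ P xs) →
                         ∀ c xs → P (insertCopies c v xs) ≡ P xs
insertCopies-invariant P-insert zero    xs = refl
insertCopies-invariant P-insert (suc c) xs =
  trans (P-insert _) (insertCopies-invariant P-insert c xs)

removeCopies-insertCopies : ∀ c v xs → removeCopies c v (insertCopies c v xs) ≡ xs
removeCopies-insertCopies zero    v xs = refl
removeCopies-insertCopies (suc c) v xs = trans
  (cong (removeCopies c v) (remove-insert v (insertCopies c v xs)))
  (removeCopies-insertCopies c v xs)

insertCopies-removeCopies : ∀ c {m v xs} → Descending m xs → c ≤ mult v xs →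
                            insertCopies c v (removeCopies c v xs) ≡ xs
insertCopies-removeCopies zero    d c≤mult = refl
insertCopies-removeCopies (suc c) {v = v} {xs} d c<mult = begin
  insert v (insertCopies c v (removeCopies c v (remove v xs)))
    ≡⟨ cong (insert v) (insertCopies-removeCopies c (remove-Descending d) c≤mult′) ⟩
  insert v (remove v xs)
    ≡⟨ insert-remove d v∈xs ⟩
  xs ∎
  where
  open ≡-Reasoning
  v∈xs : v ∈ xs
  v∈xs = mult⇒∈ xs (≤-trans (s≤s z≤n) c<mult)
  c≤mult′ : c ≤ mult v (remove v xs)
  c≤mult′ = s≤s⁻¹ (subst (suc c ≤_) (sym (mult-remove d v∈xs)) c<mult)

sum-removeCopies : ∀ c {m v xs} → Descending m xs → c ≤ mult v xs →
                   c * v + sum (removeCopies c v xs) ≡ sum xs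
sum-removeCopies c {v = v} {xs} d c≤mult = trans
  (sym (sum-insertCopies c v (removeCopies c v xs)))
  (cong sum (insertCopies-removeCopies c d c≤mult))

*≤sum : ∀ c {m v xs} → Descending m xs → c ≤ mult v xs → c * v ≤ sum xs
*≤sum c {v = v} d c≤mult = subst (c * v ≤_) (sum-removeCopies c d c≤mult) (m≤m+n (c * v) _)

-- Removing c copies of a part

shiftedCount : ℕ → (List ℕ → Bool) → ℕ → ℕ
shiftedCount s P n = if s ≤ᵇ n then countPartitions P (n ∸ s) else 0

shiftedCount-cong : ∀ {s s′ P Q} n → s ≡ s′ → (∀ m → countPartitions P m ≡ countPartitions Q m) →
                    shiftedCount s P n ≡ shiftedCount s′ Q n
shiftedCount-cong {s} n refl P≡Q = if-cong-then (s ≤ᵇ n) (P≡Q (n ∸ s))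

countPartitions-occursAtLeast : ∀ {c v} {P : List ℕ → Bool} → 1 ≤ c → 1 ≤ v →
  (∀ xs → P (insert v xs) ≡ P xs) →
  ∀ n → countPartitions (λ xs → occursAtLeast c v xs ∧ P xs) n ≡ shiftedCount (c * v) P n
countPartitions-occursAtLeast {c} {v} {P} 1≤c 1≤v P-insert n with c * v ≤ᵇ n in cv≤ᵇn
... | false = countPartitions-none n λ { (d , refl) t →
  subst T cv≤ᵇn (≤⇒≤ᵇ (*≤sum c d (≤ᵇ⇒≤ c _ (proj₁ (Equivalence.to T-∧ t))))) }
... | true  = countPartitions-byBijection (removeCopies c v) (insertCopies c v) removed inserted
  (λ { ((d , _) , t) → insertCopies-removeCopies c d (often t) })
  (λ _ → removeCopies-insertCopies c v _)
  where
  instance _ = >-nonZero 1≤c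
  cv≤n : c * v ≤ n
  cv≤n = ≤ᵇ⇒≤ (c * v) n (Equivalence.from T-≡ cv≤ᵇn)
  often : ∀ {xs} → T (occursAtLeast c v xs ∧ P xs) → c ≤ mult v xs
  often t = ≤ᵇ⇒≤ c _ (proj₁ (Equivalence.to T-∧ t))
  P-removeCopies : ∀ {m xs} → Descending m xs → c ≤ mult v xs → P (removeCopies c v xs) ≡ P xs
  P-removeCopies d c≤mult = trans
    (sym (insertCopies-invariant P-insert c _)) (cong P (insertCopies-removeCopies c d c≤mult))
  removed : ∀ {xs} → PartitionWith (λ xs → occursAtLeast c v xs ∧ P xs) n xs →
                     PartitionWith P (n ∸ c * v) (removeCopies c v xs)
  removed {xs} ((d , refl) , t) =
    (subst (λ m → Descending m (removeCopies c v xs)) sum≡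
       (Descending-sum (removeCopies-Descending c d)) , sum≡) ,
    subst T (sym (P-removeCopies d (often t))) (proj₂ (Equivalence.to T-∧ t))
    where
    sum≡ : sum (removeCopies c v xs) ≡ sum xs ∸ c * v
    sum≡ = trans (sym (m+n∸m≡n (c * v) _)) (cong (_∸ c * v) (sum-removeCopies c d (often t)))
  inserted : ∀ {ys} → PartitionWith P (n ∸ c * v) ys →
                      PartitionWith (λ xs → occursAtLeast c v xs ∧ P xs) n (insertCopies c v ys)
  inserted {ys} ((d , sum≡) , t) =
    (insertCopies-Descending c (Descending-weaken (m∸n≤m n (c * v)) d) 1≤v (≤-trans (m≤n*m v c) cv≤n) ,
     trans (sum-insertCopies c v ys) (trans (cong (c * v +_) sum≡) (m+[n∸m]≡n cv≤n))) ,
    Equivalence.from T-∧ (≤⇒≤ᵇ (subst (c ≤_) (sym (mult-insertCopies c v ys)) (m≤m+n c _)) ,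
                          subst T (sym (insertCopies-invariant P-insert c ys)) t)

-- Exactly j marked values

marked : ℕ → List ℕ → List ℕ → ℕ
marked c V xs = length (filterᵇ (λ v → occursAtLeast c v xs) V)

marked-insert : ∀ c {v} V xs → All (v ≢_) V → marked c V (insert v xs) ≡ marked c V xs
marked-insert c V xs v∉V = cong length (filterᵇ-cong V λ u∈V →
  cong (c ≤ᵇ_) (mult-insert-≢ xs (≢-sym (All.lookup v∉V u∈V))))

countPartitions-marked-∷ : ∀ {c v} V → 1 ≤ c → 1 ≤ v → All (v ≢_) V → ∀ j n →
  countPartitions (λ xs → marked c (v ∷ V) xs ≡ᵇ j) n ≡
    countPartitions (λ xs → marked c V xs ≡ᵇ j) n
      ∸ shiftedCount (c * v) (λ xs → marked c V xs ≡ᵇ j) n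
    + shiftedCount (c * v) (λ xs → suc (marked c V xs) ≡ᵇ j) n
countPartitions-marked-∷ {c} {v} V 1≤c 1≤v v∉V j n = begin
  countPartitions (λ xs → marked c (v ∷ V) xs ≡ᵇ j) n
    ≡⟨ countPartitions-cong n (λ {xs} _ → marked-∷ xs) ⟩
  countPartitions (λ xs → if C xs then E⁺ xs else E xs) n
    ≡⟨ countPartitions-if C E E⁺ n ⟩
  countPartitions (λ xs → not (C xs) ∧ E xs) n + countPartitions (λ xs → C xs ∧ E⁺ xs) n
    ≡⟨ cong₂ _+_ unmarked (withMarked (λ m → suc m ≡ᵇ j)) ⟩
  countPartitions E n ∸ shiftedCount (c * v) E n + shiftedCount (c * v) E⁺ n ∎
  where
  open ≡-Reasoning
  C E E⁺ : List ℕ → Bool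
  C xs  = occursAtLeast c v xs
  E xs  = marked c V xs ≡ᵇ j
  E⁺ xs = suc (marked c V xs) ≡ᵇ j
  marked-∷ : ∀ xs → (marked c (v ∷ V) xs ≡ᵇ j) ≡ (if C xs then E⁺ xs else E xs)
  marked-∷ xs with C xs
  ... | true  = refl
  ... | false = refl
  withMarked : (g : ℕ → Bool) → countPartitions (λ xs → C xs ∧ g (marked c V xs)) n ≡
                                 shiftedCount (c * v) (λ xs → g (marked c V xs)) n
  withMarked g = countPartitions-occursAtLeast 1≤c 1≤v (λ xs → cong g (marked-insert c V xs v∉V)) n
  unmarked : countPartitions (λ xs → not (C xs) ∧ E xs) n ≡
             countPartitions E n ∸ shiftedCount (c * v) E n
  unmarked = begin
    countPartitions (λ xs → not (C xs) ∧ E xs) n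
      ≡⟨ m+n∸n≡m _ (countPartitions (λ xs → C xs ∧ E xs) n) ⟨
    countPartitions (λ xs → not (C xs) ∧ E xs) n + countPartitions (λ xs → C xs ∧ E xs) n
      ∸ countPartitions (λ xs → C xs ∧ E xs) n
      ≡⟨ cong₂ _∸_ (sym (countPartitions-split C E n)) (withMarked (_≡ᵇ j)) ⟩
    countPartitions E n ∸ shiftedCount (c * v) E n ∎

countPartitions-marked-≡ : ∀ {c c′} → 1 ≤ c → 1 ≤ c′ → ∀ {V V′} → Unique V → Unique V′ →
  All (1 ≤_) V → All (1 ≤_) V′ → map (c *_) V ≡ map (c′ *_) V′ → ∀ j n →
  countPartitions (λ xs → marked c V xs ≡ᵇ j) n ≡ countPartitions (λ xs → marked c′ V′ xs ≡ᵇ j) n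
countPartitions-marked-≡ _ _ {[]} {[]} _ _ _ _ _ j n = refl
countPartitions-marked-≡ {c} {c′} 1≤c 1≤c′ {v ∷ V} {v′ ∷ V′} (v∉V ∷ uniqueV) (v′∉V′ ∷ uniqueV′)
  (1≤v ∷ positiveV) (1≤v′ ∷ positiveV′) weights j n = begin
  countPartitions (λ xs → marked c (v ∷ V) xs ≡ᵇ j) n
    ≡⟨ countPartitions-marked-∷ V 1≤c 1≤v v∉V j n ⟩
  countPartitions (λ xs → marked c V xs ≡ᵇ j) n
    ∸ shiftedCount (c * v) (λ xs → marked c V xs ≡ᵇ j) n
    + shiftedCount (c * v) (λ xs → suc (marked c V xs) ≡ᵇ j) n
    ≡⟨ cong₂ _+_ (cong₂ _∸_ (ih j n) (shiftedCount-cong n weight (ih j)))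
                 (shiftedCount-cong n weight (ih⁺ j)) ⟩
  countPartitions (λ xs → marked c′ V′ xs ≡ᵇ j) n
    ∸ shiftedCount (c′ * v′) (λ xs → marked c′ V′ xs ≡ᵇ j) n
    + shiftedCount (c′ * v′) (λ xs → suc (marked c′ V′ xs) ≡ᵇ j) n
    ≡⟨ countPartitions-marked-∷ V′ 1≤c′ 1≤v′ v′∉V′ j n ⟨
  countPartitions (λ xs → marked c′ (v′ ∷ V′) xs ≡ᵇ j) n ∎
  where
  open ≡-Reasoning
  weight : c * v ≡ c′ * v′
  weight = proj₁ (∷-injective weights)
  ih : ∀ j m → countPartitions (λ xs → marked c V xs ≡ᵇ j) m ≡
               countPartitions (λ xs → marked c′ V′ xs ≡ᵇ j) m
  ih = countPartitions-marked-≡ 1≤c 1≤c′ uniqueV uniqueV′ positiveV positiveV′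
                                (proj₂ (∷-injective weights))
  ih⁺ : ∀ j m → countPartitions (λ xs → suc (marked c V xs) ≡ᵇ j) m ≡
                countPartitions (λ xs → suc (marked c′ V′ xs) ≡ᵇ j) m
  ih⁺ zero    m = refl
  ih⁺ (suc j) m = ih j m

countPartitions-marked-scaled : ∀ {k} → 1 ≤ k → ∀ {V} → Unique V → All (1 ≤_) V → ∀ j n →
  countPartitions (λ xs → marked k V xs ≡ᵇ j) n ≡
  countPartitions (λ xs → marked 1 (map (k *_) V) xs ≡ᵇ j) n
countPartitions-marked-scaled {k} 1≤k {V} uniqueV positiveV =
  countPartitions-marked-≡ 1≤k ≤-refl uniqueV (Unique.map⁺ (*-cancelˡ-≡ _ _ k) uniqueV)
    positiveV (All.map⁺ (All.map (*-mono-≤ 1≤k) positiveV))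
    (sym (map-id-local (All.universal *-identityˡ _)))
  where instance _ = >-nonZero 1≤k

-- The congruence conditions

∈-distinctParts⁻ : ∀ {v} xs → v ∈ distinctParts xs → v ∈ xs
∈-distinctParts⁻ xs = ∈-deduplicate⁻ (T? ∘₂ _≡ᵇ_) xs

∈-distinctParts⁺ : ∀ {v xs} → v ∈ xs → v ∈ distinctParts xs
∈-distinctParts⁺ = SetoidMembership.∈-deduplicate⁺ (setoid ℕ) (T? ∘₂ _≡ᵇ_)
  (λ z≡ᵇy x≡y → trans x≡y (sym (≡ᵇ⇒≡ _ _ z≡ᵇy)))

distinctParts-unique : ∀ xs → Unique (distinctParts xs)
distinctParts-unique []       = []
distinctParts-unique (x ∷ xs) =
  All.map (λ x≢ᵇy x≡y → x≢ᵇy (≡⇒≡ᵇ _ _ x≡y))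
          (All.all-filter (¬? ∘ T? ∘ (x ≡ᵇ_)) (distinctParts xs))
  ∷ Unique.filter⁺ (¬? ∘ T? ∘ (x ≡ᵇ_)) (distinctParts-unique xs)

module _ (p k : ℕ) .{{_ : NonZero p}} .{{_ : NonZero k}} {{_ : NonZero (p * k)}} where

  [k*v]%[p*k]≡k*[v%p] : ∀ v → (k * v) % (p * k) ≡ k * (v % p)
  [k*v]%[p*k]≡k*[v%p] v = begin
    (k * v) % (p * k) ≡⟨ cong (_% (p * k)) (*-comm k v) ⟩
    (v * k) % (p * k) ≡⟨ m%n*o≡m*o%[n*o] v p k ⟨
    v % p * k         ≡⟨ *-comm (v % p) k ⟩
    k * (v % p)       ∎
    where open ≡-Reasoning

  %[p*k]≡k*r⇒ : ∀ {w r} → w % (p * k) ≡ k * r → k * (w / k) ≡ w × (w / k) % p ≡ r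
  %[p*k]≡k*r⇒ {w} {r} w%≡ = m*[n/m]≡n k∣w , (begin
    w / k % p       ≡⟨ m%[n*o]/o≡m/o%n w p k ⟨
    w % (p * k) / k ≡⟨ cong (_/ k) w%≡ ⟩
    k * r / k       ≡⟨ cong (_/ k) (*-comm k r) ⟩
    r * k / k       ≡⟨ m*n/n≡m r k ⟩
    r               ∎)
    where
    open ≡-Reasoning
    k∣w : k ∣ w
    k∣w = ∣n∣m%n⇒∣m (n∣m*n p) (subst (k ∣_) (sym w%≡) (m∣m*n r))

module _ (p r : ℕ) .{{_ : NonZero p}} where

  congruent : ℕ → Bool
  congruent v = v % p ≡ᵇ r

  congruentUpTo : ℕ → List ℕ
  congruentUpTo n = filterᵇ congruent (oneTo n)

  congruentUpTo-unique : ∀ n → Unique (congruentUpTo n)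
  congruentUpTo-unique n = filterᵇ-unique congruent (oneTo-unique n)

  congruentUpTo-positive : ∀ n → All (1 ≤_) (congruentUpTo n)
  congruentUpTo-positive n =
    All.tabulate (proj₁ ∘ ∈-oneTo⁻ ∘ proj₁ ∘ ∈-filterᵇ⁻ congruent {xs = oneTo n})

module _ (p k r : ℕ) .{{_ : NonZero p}} .{{_ : NonZero k}} {{_ : NonZero (p * k)}}
         {n xs} (partition : IsPartition n xs) where

  private
    often present : ℕ → Bool
    often v   = occursAtLeast k v xs
    present v = occursAtLeast 1 v xs

    bounds : ∀ {v} → v ∈ xs → 1 ≤ v × v ≤ n
    bounds = ∈-Descending (proj₁ partition)

  dCond-marked : dCond p k r xs ≡ (marked k (congruentUpTo p r n) xs ≡ᵇ 1)
  dCond-marked = cong (_≡ᵇ 1) (length-≡-bySameElements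
    (filterᵇ-unique _ (distinctParts-unique xs))
    (filterᵇ-unique often (congruentUpTo-unique p r n)) ⊆ ⊇)
    where
    ⊆ : ∀ {v} → v ∈ filterᵇ (λ v → congruent p r v ∧ often v) (distinctParts xs) →
                v ∈ filterᵇ often (congruentUpTo p r n)
    ⊆ v∈ with v∈parts , t ← ∈-filterᵇ⁻ (λ v → congruent p r v ∧ often v) v∈
         with v-congruent , v-often ← Equivalence.to T-∧ t =
      ∈-filterᵇ⁺ often (∈-filterᵇ⁺ (congruent p r) v∈oneTo v-congruent) v-often
      where
      v∈oneTo : _ ∈ oneTo n
      v∈oneTo = uncurry ∈-oneTo⁺ (bounds (∈-distinctParts⁻ xs v∈parts))
    ⊇ : ∀ {v} → v ∈ filterᵇ often (congruentUpTo p r n) →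
                v ∈ filterᵇ (λ v → congruent p r v ∧ often v) (distinctParts xs)
    ⊇ v∈ with v∈congruent , v-often ← ∈-filterᵇ⁻ often {xs = congruentUpTo p r n} v∈
         with _ , v-congruent ← ∈-filterᵇ⁻ (congruent p r) {xs = oneTo n} v∈congruent =
      ∈-filterᵇ⁺ (λ v → congruent p r v ∧ often v)
        (∈-distinctParts⁺ (mult⇒∈ xs (≤-trans (>-nonZero⁻¹ k) (≤ᵇ⇒≤ k _ v-often))))
        (Equivalence.from T-∧ (v-congruent , v-often))

  fCond-marked : fCond p k r xs ≡ (marked 1 (map (k *_) (congruentUpTo p r n)) xs ≡ᵇ 1)
  fCond-marked = cong (_≡ᵇ 1) (length-≡-bySameElements
    (filterᵇ-unique _ (distinctParts-unique xs))
    (filterᵇ-unique present (Unique.map⁺ (*-cancelˡ-≡ _ _ k) (congruentUpTo-unique p r n))) ⊆ ⊇)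
    where
    ⊆ : ∀ {w} → w ∈ filterᵇ (λ w → w % (p * k) ≡ᵇ k * r) (distinctParts xs) →
                w ∈ filterᵇ present (map (k *_) (congruentUpTo p r n))
    ⊆ {w} w∈ with w∈parts , w%≡ ← ∈-filterᵇ⁻ (λ w → w % (p * k) ≡ᵇ k * r) w∈
             with k*u≡w , u-congruent ← %[p*k]≡k*r⇒ p k (≡ᵇ⇒≡ _ _ w%≡) =
      ∈-filterᵇ⁺ present
        (subst (_∈ map (k *_) (congruentUpTo p r n)) k*u≡w
          (∈-map⁺ (k *_) (∈-filterᵇ⁺ (congruent p r) (∈-oneTo⁺ 1≤u u≤n) (≡⇒≡ᵇ _ _ u-congruent))))
        (≤⇒≤ᵇ (∈⇒mult w∈xs))
      where
      w∈xs : w ∈ xs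
      w∈xs = ∈-distinctParts⁻ xs w∈parts
      1≤u : 1 ≤ w / k
      1≤u = >-nonZero⁻¹ (w / k) {{m*n≢0⇒n≢0 k}}
        where instance _ = >-nonZero (subst (1 ≤_) (sym k*u≡w) (proj₁ (bounds w∈xs)))
      u≤n : w / k ≤ n
      u≤n = ≤-trans (m/n≤m w k) (proj₂ (bounds w∈xs))
    ⊇ : ∀ {w} → w ∈ filterᵇ present (map (k *_) (congruentUpTo p r n)) →
                w ∈ filterᵇ (λ w → w % (p * k) ≡ᵇ k * r) (distinctParts xs)
    ⊇ w∈ with w∈multiples , w-present ← ∈-filterᵇ⁻ present {xs = map (k *_) (congruentUpTo p r n)} w∈
         with u , u∈congruent , refl ← ∈-map⁻ (k *_) w∈multiples
         with _ , u-congruent ← ∈-filterᵇ⁻ (congruent p r) {xs = oneTo n} u∈congruent =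
      ∈-filterᵇ⁺ (λ w → w % (p * k) ≡ᵇ k * r) (∈-distinctParts⁺ (mult⇒∈ xs (≤ᵇ⇒≤ 1 _ w-present)))
        (≡⇒≡ᵇ _ _ (trans ([k*v]%[p*k]≡k*[v%p] p k u) (cong (k *_) (≡ᵇ⇒≡ _ _ u-congruent))))

theorem6 : (k p r : ℕ) → 2 ≤ k → 2 ≤ p → r < p →
           (n : ℕ) → 1 ≤ n →
           {{_ : NonZero p}} → {{_ : NonZero (p * k)}} →
           f p k r n ≡ d p k r n
theorem6 k p r 2≤k _ _ n _ = begin
  f p k r n
    ≡⟨ countPartitions-cong n (fCond-marked p k r) ⟩
  countPartitions (λ xs → marked 1 (map (k *_) V) xs ≡ᵇ 1) n
    ≡⟨ countPartitions-marked-scaled 1≤k (congruentUpTo-unique p r n) (congruentUpTo-positive p r n)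
                                     1 n ⟨
  countPartitions (λ xs → marked k V xs ≡ᵇ 1) n
    ≡⟨ countPartitions-cong n (dCond-marked p k r) ⟨
  d p k r n ∎
  where
  open ≡-Reasoning
  V : List ℕ
  V = congruentUpTo p r n
  1≤k : 1 ≤ k
  1≤k = ≤-trans (s≤s z≤n) 2≤k
  instance _ = >-nonZero 1≤k
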